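{- Let $m,k\in\mathbb{N}$ with $k\ge 2$, and let $\pi_1,\dots,\pi_k$ be primes with $\pi_1=2$ and $\pi_i\neq 2$ for $i=2,\dots,k$. Then there exists $a\in\mathbb{Z}$ such that $\{\pi_i\}_{i=2}^k$ covers $\langle a\rangle_m$ if and only if there exists $b\in\mathbb{Z}$ such that $\{\pi_i\}_{i=1}^k$ covers $\langle b\rangle_{2m+1}$.
   Context: For $a\in\mathbb{Z}$ and $m\in\mathbb{N}$, $\langle a\rangle_m$ denotes the sequence of consecutive integers $(a+1,a+2,\dots,a+m)$ (note $a$ itself is not a member). A set of primes $\{\pi_i\}_{i\in I}$ is said to cover $\langle a\rangle_m$ if for every $x\in\{1,\dots,m\}$ there is an $i\in I$ with $\pi_i\mid a+x$. $\mathbb{N}$ denotes the positive integers. -}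

module Defs where

open import Data.Nat using (ℕ; _≤_)
open import Data.Fin using (Fin)
open import Data.Integer using (ℤ; +_; _+_)
open import Data.Integer.Divisibility using (_∣_)
open import Data.Product using (∃)

-- A finite family of primes π : Fin n → ℕ covers ⟨a⟩_m = (a+1, …, a+m)
-- if every member a + x (1 ≤ x ≤ m) is divisible by some π i.
Covers : {n : ℕ} → (Fin n → ℕ) → ℤ → ℕ → Set
Covers {n} π a m = ∀ (x : ℕ) → 1 ≤ x → x ≤ m → ∃ λ (i : Fin n) → (+ π i) ∣ (a + + x)

module Submission where

-- Proof idea.  Let Q = 2T + 1 be an odd common multiple of the odd primes
-- π₂, …, π_k (their product will do).
--
-- (⇒) If π₂, …, π_k cover ⟨a⟩_m, then π₁, …, π_k cover ⟨2a + Q⟩_{2m+1}: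
--     for an odd offset y the number 2a + Q + y is even, so π₁ = 2 divides it;
--     for an even offset y = 2x we have 2a + Q + y = 2(a + x) + Q, and the
--     prime dividing a + x also divides Q.
-- (⇐) If π₁, …, π_k cover ⟨b⟩_{2m+1}, pick c ∈ {b, b + 1} odd.  The odd numbers
--     c + 2x (1 ≤ x ≤ m) lie in ⟨b⟩_{2m+1}, so each is divisible by an odd π_i.
--     Put a = c(T + 1); then 2(a + x) = cQ + (c + 2x), hence π_i ∣ 2(a + x),
--     and as π_i is an odd prime, π_i ∣ a + x.

open import Defs
open import Data.Nat using (ℕ; suc; _≤_; _*_; _+_)
open import Data.Nat.Primality using (Prime)
open import Data.Fin using (Fin; zero; suc)
open import Data.Integer using (ℤ)
open import Data.Product using (∃)
open import Relation.Binary.PropositionalEquality using (_≡_; _≢_)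
open import Function.Bundles using (_⇔_)

open import Data.Nat using (zero; z≤n; s≤s; _<_)
import Data.Nat.Properties as ℕP
import Data.Nat.Divisibility as ℕD
open import Data.Nat.Primality using (prime⇒irreducible; euclidsLemma; prime[2]; ¬prime[1])
import Data.Nat.Tactic.RingSolver as ℕRing
open import Data.Integer as Z using (+_)
import Data.Integer.Properties as ZP
import Data.Integer.Divisibility as Unsigned
open import Data.Integer.Divisibility.Signed using (_∣_; _∣?_; ∣ᵤ⇒∣; ∣⇒∣ᵤ;
  ∣-refl; ∣m∣n⇒∣m+n; ∣m+n∣m⇒∣n; ∣m+n∣n⇒∣m; ∣n⇒∣m*n; ∣m⇒∣m*n)
open import Data.Integer.Tactic.RingSolver using (solve-∀)
open import Data.Product using (_,_; _×_; proj₁; proj₂)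
open import Data.Sum using (_⊎_; inj₁; inj₂)
open import Data.Empty using (⊥-elim)
open import Relation.Nullary using (¬_; yes; no)
open import Relation.Binary.PropositionalEquality using (refl; sym; trans; cong; subst; module ≡-Reasoning)
open import Function using (_∘_)
open import Function.Bundles using (mk⇔)

Odd : ℕ → Set
Odd n = ∃ λ t → n ≡ suc (2 * t)

even-or-odd : ∀ n → ∃ λ x → n ≡ 2 * x ⊎ n ≡ suc (2 * x)
even-or-odd zero = 0 , inj₁ refl
even-or-odd (suc n) with even-or-odd n
... | x , inj₁ n≡2x   = x , inj₂ (cong suc n≡2x)
... | x , inj₂ n≡2x+1 = suc x , inj₁ (trans (cong suc n≡2x+1) (step x))
  where
  step : ∀ x → suc (suc (2 * x)) ≡ 2 * suc x
  step = ℕRing.solve-∀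

-- A prime other than 2 is odd: an even prime is divisible by 2, hence equals 2.
prime≢2⇒odd : ∀ {p} → Prime p → p ≢ 2 → Odd p
prime≢2⇒odd {p} p-prime p≢2 with even-or-odd p
... | t , inj₂ p≡2t+1 = t , p≡2t+1
... | t , inj₁ p≡2t
    with prime⇒irreducible p-prime (ℕD.divides t (trans p≡2t (ℕP.*-comm 2 t)))
...   | inj₁ ()
...   | inj₂ 2≡p = ⊥-elim (p≢2 (sym 2≡p))

odd-* : ∀ {m n} → Odd m → Odd n → Odd (m * n)
odd-* (u , refl) (v , refl) = u * suc (2 * v) + v , expand u v
  where
  expand : ∀ u v → suc (2 * u) * suc (2 * v) ≡ suc (2 * (u * suc (2 * v) + v))
  expand = ℕRing.solve-∀

odd-common-multiple : ∀ {n} (f : Fin n → ℕ) → (∀ i → Odd (f i)) →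
  ∃ λ Q → Odd Q × (∀ i → f i ℕD.∣ Q)
odd-common-multiple {zero} f f-odd = 1 , (0 , refl) , λ ()
odd-common-multiple {suc n} f f-odd
    with odd-common-multiple (f ∘ suc) (f-odd ∘ suc)
... | Q , Q-odd , tail∣Q = f zero * Q , odd-* (f-odd zero) Q-odd , ∣product
  where
  ∣product : ∀ i → f i ℕD.∣ f zero * Q
  ∣product zero    = ℕD.m∣m*n Q
  ∣product (suc i) = ℕD.∣-trans (tail∣Q i) (ℕD.n∣m*n (f zero))

-- An odd prime dividing 2z divides z (Euclid's lemma, as p ∤ 2).
odd-prime-∣2*⇒∣ : ∀ {p} → Prime p → p ≢ 2 → ∀ z → + p ∣ + 2 Z.* z → + p ∣ z
odd-prime-∣2*⇒∣ {p} p-prime p≢2 z p∣2z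
    with euclidsLemma 2 Z.∣ z ∣ p-prime (subst (p ℕD.∣_) (ZP.abs-* (+ 2) z) (∣⇒∣ᵤ p∣2z))
... | inj₂ p∣z = ∣ᵤ⇒∣ p∣z
... | inj₁ p∣2 with prime⇒irreducible prime[2] p∣2
...   | inj₁ p≡1 = ⊥-elim (¬prime[1] (subst Prime p≡1 p-prime))
...   | inj₂ p≡2 = ⊥-elim (p≢2 p≡2)

+odd : ∀ n → + suc (2 * n) ≡ + 1 Z.+ + 2 Z.* + n
+odd n = trans (ZP.pos-+ 1 (2 * n)) (cong (λ v → + 1 Z.+ v) (ZP.pos-* 2 n))

half-offset-bounds : ∀ {x m} → 1 ≤ 2 * x → 2 * x ≤ 2 * m + 1 → 1 ≤ x × x ≤ m
half-offset-bounds {zero} ()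
half-offset-bounds {suc x} {m} _ 2x≤2m+1 =
  s≤s z≤n , ℕP.≤-pred (ℕP.*-cancelˡ-< 2 (suc x) (suc m) 2x<2[m+1])
  where
  double-suc : ∀ m → suc (2 * m + 1) ≡ 2 * suc m
  double-suc = ℕRing.solve-∀
  2x<2[m+1] : 2 * suc x < 2 * suc m
  2x<2[m+1] = subst (2 * suc x <_) (double-suc m) (s≤s 2x≤2m+1)

-- If π ∘ suc covers ⟨a⟩_m, π zero = 2, and every π (suc i)
-- divides the odd number Q, then π covers ⟨2a + Q⟩_{2m+1}: odd offsets give
-- even members, and an even offset 2x gives 2(a + x) + Q.
double-cover : ∀ {k} (π : Fin (suc k) → ℕ) → π zero ≡ 2 →
  ∀ {Q} → Odd Q → (∀ i → π (suc i) ℕD.∣ Q) →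
  ∀ {a m} → Covers (π ∘ suc) a m → Covers π (+ 2 Z.* a Z.+ + Q) (2 * m + 1)
double-cover π π0≡2 {Q} (T , refl) tail∣Q {a} {m} cover y 1≤y y≤2m+1
    with even-or-odd y
... | x , inj₂ refl = zero , ∣⇒∣ᵤ π0∣member
  where
  odd+odd : ∀ a T x → + 2 Z.* a Z.+ (+ 1 Z.+ + 2 Z.* T) Z.+ (+ 1 Z.+ + 2 Z.* x)
                      ≡ + 2 Z.* (a Z.+ T Z.+ x Z.+ + 1)
  odd+odd = solve-∀
  2∣member : + 2 ∣ + 2 Z.* a Z.+ + suc (2 * T) Z.+ + suc (2 * x)
  2∣member rewrite +odd T | +odd x | odd+odd a (+ T) (+ x) = ∣m⇒∣m*n _ ∣-refl
  π0∣member : + π zero ∣ + 2 Z.* a Z.+ + suc (2 * T) Z.+ + suc (2 * x)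
  π0∣member = subst (λ p → + p ∣ + 2 Z.* a Z.+ + suc (2 * T) Z.+ + suc (2 * x)) (sym π0≡2) 2∣member
... | x , inj₁ refl with half-offset-bounds {x} {m} 1≤y y≤2m+1
...   | 1≤x , x≤m with cover x 1≤x x≤m
...     | i , p∣a+x = suc i , ∣⇒∣ᵤ (subst (+ π (suc i) ∣_) (sym (regroup a (+ Q) x)) p∣member)
  where
  regroup : ∀ a Q x → + 2 Z.* a Z.+ Q Z.+ + (2 * x) ≡ + 2 Z.* (a Z.+ + x) Z.+ Q
  regroup a Q x rewrite ZP.pos-* 2 x = ring a Q (+ x)
    where
    ring : ∀ a Q x → + 2 Z.* a Z.+ Q Z.+ + 2 Z.* x ≡ + 2 Z.* (a Z.+ x) Z.+ Q
    ring = solve-∀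
  p∣member : + π (suc i) ∣ + 2 Z.* (a Z.+ + x) Z.+ + Q
  p∣member = ∣m∣n⇒∣m+n (∣n⇒∣m*n (+ 2) (∣ᵤ⇒∣ {i = a Z.+ + x} p∣a+x)) (∣ᵤ⇒∣ {i = + Q} (tail∣Q i))

odd-neighbour : ∀ b → ∃ λ d → d ≤ 1 × ¬ (+ 2 ∣ b Z.+ + d)
odd-neighbour b with + 2 ∣? b Z.+ + 1
... | no 2∤b+1 = 1 , s≤s z≤n , 2∤b+1
... | yes 2∣b+1 = 0 , z≤n , λ 2∣b+0 →
        2∤1 (∣m+n∣m⇒∣n 2∣b+1 (subst (+ 2 ∣_) (ZP.+-identityʳ b) 2∣b+0))
  where
  2∤1 : ¬ (+ 2 ∣ + 1)
  2∤1 2∣1 with ℕD.∣⇒≤ (∣⇒∣ᵤ 2∣1)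
  ... | s≤s ()

odd-offset-bounds : ∀ {d x m} → d ≤ 1 → 1 ≤ x → x ≤ m →
  1 ≤ d + 2 * x × d + 2 * x ≤ 2 * m + 1
odd-offset-bounds {d} {x} {m} d≤1 1≤x x≤m =
  ℕP.≤-trans 1≤x (ℕP.≤-trans (ℕP.m≤m+n x (x + 0)) (ℕP.m≤n+m (2 * x) d)) ,
  ℕP.≤-trans (ℕP.+-mono-≤ d≤1 (ℕP.*-monoʳ-≤ 2 x≤m)) (ℕP.≤-reflexive (ℕP.+-comm 1 (2 * m)))

odd-members-avoid-2 : ∀ {k} (π : Fin (suc k) → ℕ) → π zero ≡ 2 →
  ∀ {b m} → Covers π b (2 * m + 1) → ∀ {d} → d ≤ 1 → ¬ (+ 2 ∣ b Z.+ + d) →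
  ∀ {x} → 1 ≤ x → x ≤ m → ∃ λ j → + π (suc j) ∣ b Z.+ + d Z.+ + 2 Z.* + x
odd-members-avoid-2 π π0≡2 {b} {m} cover {d} d≤1 b+d-odd {x} 1≤x x≤m =
  avoid-2 (cover (d + 2 * x) (proj₁ bounds) (proj₂ bounds))
  where
  bounds : 1 ≤ d + 2 * x × d + 2 * x ≤ 2 * m + 1
  bounds = odd-offset-bounds d≤1 1≤x x≤m
  member : b Z.+ + (d + 2 * x) ≡ b Z.+ + d Z.+ + 2 Z.* + x
  member = trans (cong (λ v → b Z.+ v) (trans (ZP.pos-+ d (2 * x)) (cong (λ v → + d Z.+ v) (ZP.pos-* 2 x))))
                 (sym (ZP.+-assoc b (+ d) (+ 2 Z.* + x)))
  avoid-2 : (∃ λ i → + π i Unsigned.∣ b Z.+ + (d + 2 * x)) →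
            ∃ λ j → + π (suc j) ∣ b Z.+ + d Z.+ + 2 Z.* + x
  avoid-2 (zero , 2∣member) = ⊥-elim (b+d-odd (∣m+n∣n⇒∣m 2∣member′ (∣m⇒∣m*n (+ x) ∣-refl)))
    where
    2∣member′ : + 2 ∣ b Z.+ + d Z.+ + 2 Z.* + x
    2∣member′ = subst (λ p → + p ∣ _) π0≡2 (subst (_ ∣_) member (∣ᵤ⇒∣ 2∣member))
  avoid-2 (suc j , p∣member) = j , subst (_ ∣_) member (∣ᵤ⇒∣ p∣member)

-- Halving: an odd prime p dividing Q = 2T + 1 and c + 2x divides c(T + 1) + x,
-- because 2(c(T + 1) + x) = cQ + (c + 2x).
halve-divisibility : ∀ {p} → Prime p → p ≢ 2 → ∀ {T} → p ℕD.∣ suc (2 * T) →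
  ∀ c x → + p ∣ c Z.+ + 2 Z.* x → + p ∣ c Z.* + suc T Z.+ x
halve-divisibility p-prime p≢2 {T} p∣Q c x p∣c+2x =
  odd-prime-∣2*⇒∣ p-prime p≢2 _
    (subst (_ ∣_) (twice c T x) (∣m∣n⇒∣m+n (∣n⇒∣m*n c (∣ᵤ⇒∣ p∣Q)) p∣c+2x))
  where
  ring : ∀ c T x → c Z.* (+ 1 Z.+ + 2 Z.* T) Z.+ (c Z.+ + 2 Z.* x)
                   ≡ + 2 Z.* (c Z.* (+ 1 Z.+ T) Z.+ x)
  ring = solve-∀
  twice : ∀ c T x → c Z.* + suc (2 * T) Z.+ (c Z.+ + 2 Z.* x) ≡ + 2 Z.* (c Z.* + suc T Z.+ x)
  twice c T x = begin
    c Z.* + suc (2 * T) Z.+ (c Z.+ + 2 Z.* x)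
      ≡⟨ cong (λ q → c Z.* q Z.+ (c Z.+ + 2 Z.* x)) (+odd T) ⟩
    c Z.* (+ 1 Z.+ + 2 Z.* + T) Z.+ (c Z.+ + 2 Z.* x)
      ≡⟨ ring c (+ T) x ⟩
    + 2 Z.* (c Z.* (+ 1 Z.+ + T) Z.+ x)
      ≡⟨ cong (λ v → + 2 Z.* (c Z.* v Z.+ x)) (ZP.pos-+ 1 T) ⟨
    + 2 Z.* (c Z.* + suc T Z.+ x)
      ∎
    where open ≡-Reasoning

halve-cover : ∀ {k} (π : Fin (suc k) → ℕ) → π zero ≡ 2 →
  (∀ i → Prime (π (suc i))) → (∀ i → π (suc i) ≢ 2) →
  ∀ {Q} → Odd Q → (∀ i → π (suc i) ℕD.∣ Q) →
  ∀ {b m} → Covers π b (2 * m + 1) → ∃ λ a → Covers (π ∘ suc) a m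
halve-cover π π0≡2 tail-prime tail≢2 (T , refl) tail∣Q {b} {m} cover
    with odd-neighbour b
... | d , d≤1 , b+d-odd = (b Z.+ + d) Z.* + suc T , halved
  where
  halved : Covers (π ∘ suc) ((b Z.+ + d) Z.* + suc T) m
  halved x 1≤x x≤m with odd-members-avoid-2 π π0≡2 {b} {m} cover d≤1 b+d-odd 1≤x x≤m
  ... | j , p∣member =
    j , ∣⇒∣ᵤ (halve-divisibility (tail-prime j) (tail≢2 j) (tail∣Q j) (b Z.+ + d) (+ x) p∣member)

-- The theorem: take Q an odd common multiple of the odd primes π₂, …, π_k,
-- then double a cover for (⇒) and halve one for (⇐).
lemma1 : (m k' : ℕ) → 1 ≤ m → 2 ≤ suc k' → (π : Fin (suc k') → ℕ) →
    (∀ i → Prime (π i)) → π zero ≡ 2 → (∀ (i : Fin k') → π (suc i) ≢ 2) →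
    (∃ λ (a : ℤ) → Covers (λ i → π (suc i)) a m) ⇔ (∃ λ (b : ℤ) → Covers π b (2 * m + 1))
lemma1 m k' _ _ π π-prime π0≡2 tail≢2
    with odd-common-multiple (π ∘ suc) (λ i → prime≢2⇒odd (π-prime (suc i)) (tail≢2 i))
... | Q , Q-odd , tail∣Q = mk⇔
  (λ (a , cover) → + 2 Z.* a Z.+ + Q , double-cover π π0≡2 Q-odd tail∣Q {a} {m} cover)
  (λ (b , cover) → halve-cover π π0≡2 (π-prime ∘ suc) tail≢2 Q-odd tail∣Q {b} {m} cover)
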